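{- Let $n\ge2$ and let $T$ be a triangle of order $n$ all of whose rows $1,\dots,n-1$ are $\mathcal{X}$-rows. Then $T$ is admissible if and only if $T\in\mathcal{O}_n$.
   Context: Let $\mathcal{X}=\{x_i,y_i:1\le i\le n\}$ be formal symbols. For $1\le k\le n-1$, let $\mathcal{V}_k=\{a_{ij},b_{ij}:1\le i<j\le n,\ j-i=k\}$ be formal symbols. A triangle of order $n$ is an array with rows $1,\dots,n$, where row $r$ has $r$ entries at positions $1,\dots,r$. Row $n$ is $1,2,\dots,n$, and the entries of rows $1,\dots,n-1$ lie in $\mathcal{X}\cup\mathcal{V}_1\cup\dots\cup\mathcal{V}_{n-1}$. There is also a notional empty row $0$. A row $r\in\{1,\dots,n-1\}$ is an $\mathcal{X}$-row if all its entries lie in $\mathcal{X}$, and a $\mathcal{V}$-row if all its entries lie in a single $\mathcal{V}_k$; row $0$ counts as both. An arrangement is a triple $(u,v,w)$ such that, for some $2\le e\le n$ and $1\le p\le e-1$, $u$ and $w$ are the entries at positions $p$ and $p+1$ of row $e$ and $v$ is the entry at position $p$ of row $e-1$. An admissible ranking assigns a nonnegative integer rank to each row $0,\dots,n$ such that: - row $n$ has rank $0$ and row $n-1$ has rank $1$; - for each $1\le r\le n-1$, if row $r$ has rank $k$ then either row $r$ is an $\mathcal{X}$-row and row $r-1$ has rank $k$, or all entries of row $r$ lie in $\mathcal{V}_k$ and row $r-1$ has rank $k+1$. Such a ranking is unique if it exists; a triangle with one is called ranked. In a ranked triangle, an entry $u$ in a row of rank $t$ has a left value $l(u)$ and a right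 value $r(u)$: - for $u=a_{ij}$ or $b_{ij}$: $l=i$, $r=j$; - for $u=x_i$: $l=i$, $r=i+t$; - for $u=y_j$: $l=j-t$, $r=j$; - for the integer $u=i$ in row $n$: $l=r=i$. The triangle has the monotone diagonal property if every arrangement $(u,v,w)$ satisfies $l(u)\le l(v)$ and $r(v)\le r(w)$, together with $l(u)<l(v)$ whenever $u$ is some $y_j$ and $r(v)<r(w)$ whenever $w$ is some $x_j$. It has the monotone row property if every arrangement satisfies $l(u)<l(w)$. A triangle is admissible if it is ranked and has both properties. A complete monotone triangle of order $n$ is a triangular array of integers with rows $1..n$, where row $k$ has $k$ strictly increasing entries, row $n$ is $1,\dots,n$, and each entry $j$ at position $p$ of a row $k<n$ satisfies $i\le j\le k'$ for the entries $i,k'$ at positions $p,p+1$ of row $k+1$. In an oriented complete monotone triangle each entry $j$ in rows $1..n-1$ is oriented right (written $x_j$) or left (written $y_j$): it must be right if $i=j<k'$, must be left if $i<j=k'$, and may be either if $i<j<k'$. $\mathcal{O}_n$ denotes the set of these, regarded as triangles of order $n$ via the symbols $x_j,y_j$. -}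

module Defs where

open import Data.Nat using (ℕ; zero; suc; _+_; _∸_; _≤_; _<_)
open import Data.Integer as ℤ using (ℤ; +_; _-_)
open import Data.Product using (_×_; Σ; ∃)
open import Data.Sum using (_⊎_)
open import Relation.Binary.PropositionalEquality using (_≡_)

-- Symbols: x i, y i (the set 𝒳), a i j, b i j (the sets 𝒱_k), and the
-- integers  num i  occurring in row n.
data Sym : Set where
  x y : ℕ → Sym
  a b : ℕ → ℕ → Sym
  num : ℕ → Sym

-- A triangle is given by its entries: T e p is the entry at position p of
-- row e (only 1 ≤ p ≤ e ≤ n is ever consulted).
Tri : Set
Tri = ℕ → ℕ → Sym

data ValidSym (n : ℕ) : Sym → Set where
  vx : ∀ {i} → 1 ≤ i → i ≤ n → ValidSym n (x i)
  vy : ∀ {i} → 1 ≤ i → i ≤ n → ValidSym n (y i)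
  va : ∀ {i j} → 1 ≤ i → i < j → j ≤ n → ValidSym n (a i j)
  vb : ∀ {i j} → 1 ≤ i → i < j → j ≤ n → ValidSym n (b i j)

IsTriangle : ℕ → Tri → Set
IsTriangle n T =
  (∀ p → 1 ≤ p → p ≤ n → T n p ≡ num p) ×
  (∀ r p → 1 ≤ r → r < n → 1 ≤ p → p ≤ r → ValidSym n (T r p))

data InX : Sym → Set where
  ix : ∀ i → InX (x i)
  iy : ∀ j → InX (y j)

data IsX : Sym → Set where
  isx : ∀ i → IsX (x i)

data IsY : Sym → Set where
  isy : ∀ j → IsY (y j)

data InV (k : ℕ) : Sym → Set where
  inva : ∀ i j → j ≡ i + k → InV k (a i j)
  invb : ∀ i j → j ≡ i + k → InV k (b i j)

XRow : Tri → ℕ → Set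
XRow T r = ∀ p → 1 ≤ p → p ≤ r → InX (T r p)

VkRow : Tri → ℕ → ℕ → Set
VkRow T r k = ∀ p → 1 ≤ p → p ≤ r → InV k (T r p)

IsRanking : ℕ → Tri → (ℕ → ℕ) → Set
IsRanking n T rk =
  rk n ≡ 0 × rk (n ∸ 1) ≡ 1 ×
  (∀ r → 1 ≤ r → r < n →
     (XRow T r × rk (r ∸ 1) ≡ rk r) ⊎
     (VkRow T r (rk r) × rk (r ∸ 1) ≡ suc (rk r)))

Ranked : ℕ → Tri → Set
Ranked n T = ∃ λ rk → IsRanking n T rk

lv : ℕ → Sym → ℤ
lv t (x i) = + i
lv t (y j) = + j - + t
lv t (a i j) = + i
lv t (b i j) = + i
lv t (num i) = + i

rv : ℕ → Sym → ℤ
rv t (x i) = + (i + t)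
rv t (y j) = + j
rv t (a i j) = + j
rv t (b i j) = + j
rv t (num i) = + i

MonotoneDiagonal : ℕ → Tri → (ℕ → ℕ) → Set
MonotoneDiagonal n T rk =
  ∀ e p → 2 ≤ e → e ≤ n → 1 ≤ p → p < e →
    let u = T e p ; w = T e (suc p) ; v = T (e ∸ 1) p
        te = rk e ; tv = rk (e ∸ 1) in
    (lv te u ℤ.≤ lv tv v) × (rv tv v ℤ.≤ rv te w) ×
    (IsY u → lv te u ℤ.< lv tv v) × (IsX w → rv tv v ℤ.< rv te w)

MonotoneRow : ℕ → Tri → (ℕ → ℕ) → Set
MonotoneRow n T rk =
  ∀ e p → 2 ≤ e → e ≤ n → 1 ≤ p → p < e →
    lv (rk e) (T e p) ℤ.< lv (rk e) (T e (suc p))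

-- admissible: ranked (the ranking is unique) with both properties
Admissible : ℕ → Tri → Set
Admissible n T = Σ (ℕ → ℕ) λ rk →
  IsRanking n T rk × MonotoneDiagonal n T rk × MonotoneRow n T rk

-- underlying integer of a symbol (only used on x, y, num)
val : Sym → ℕ
val (x i) = i
val (y j) = j
val (a i j) = 0
val (b i j) = 0
val (num i) = i

-- membership in 𝒪_n (for a triangle of order n, so row n is 1..n)
InO : ℕ → Tri → Set
InO n T =
  (∀ r p → 1 ≤ r → r < n → 1 ≤ p → p ≤ r → InX (T r p)) ×
  (∀ r p → 1 ≤ r → r < n → 1 ≤ p → p < r → val (T r p) < val (T r (suc p))) ×
  (∀ k p → 1 ≤ k → k < n → 1 ≤ p → p ≤ k →
     let i = val (T (suc k) p) ; j = val (T k p) ; k' = val (T (suc k) (suc p)) in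
     (i ≤ j) × (j ≤ k') ×
     (i ≡ j → j < k' → IsX (T k p)) ×
     (i < j → j ≡ k' → IsY (T k p)))

-- When rows 1, …, n − 1 are X-rows the ranking is forced: rank 1 above row n
-- and rank 0 at row n. At rank 1 an oriented integer x j occupies [j, j + 1]
-- and y j occupies [j − 1, j], so the monotone diagonal condition on an
-- arrangement (u, v, w) says precisely that val u ≤ val v ≤ val w, with the
-- orientation rules of 𝒪_n deciding the equality cases; the integers of row n
-- behave the same way. Monotone rows then come for free: two neighbours in a
-- row are separated by the integer between them in the row below.
module Submission where

open import Defs
open import Data.Nat using (ℕ; zero; suc; _+_; _∸_; _≤_; _<_; z≤n; s≤s)
open import Data.Nat.Properties
open import Data.Integer as ℤ using (+≤+; +<+)
open import Data.Product using (_×_; _,_; proj₁; proj₂; uncurry)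
open import Data.Sum using (inj₁; inj₂)
open import Data.Empty using (⊥-elim)
open import Function using (case_of_)
open import Function.Bundles using (_⇔_; mk⇔; module Equivalence)
open import Relation.Binary.PropositionalEquality using (_≡_; refl; sym; trans; subst; subst₂)
open import Relation.Nullary using (¬_; contradiction)

open Equivalence using (to; from)

-- Reading x j as j + ½ and y j as j − ½, these are the strict orders between
-- integers and oriented integers.
data _<ᵒ_ (i : ℕ) : Sym → Set where
  <x : ∀ {j} → i ≤ j → i <ᵒ x j
  <y : ∀ {j} → i < j → i <ᵒ y j

data _ᵒ<_ : Sym → ℕ → Set where
  x< : ∀ {j k} → j < k → x j ᵒ< k
  y< : ∀ {j k} → j ≤ k → y j ᵒ< k

<ᵒ-ᵒ<⇒< : ∀ {i v k} → i <ᵒ v → v ᵒ< k → i < k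
<ᵒ-ᵒ<⇒< (<x i≤j) (x< j<k) = <-≤-trans (s≤s i≤j) j<k
<ᵒ-ᵒ<⇒< (<y i<j) (y< j≤k) = <-≤-trans i<j j≤k

Interlaces : ℕ → Sym → ℕ → Set
Interlaces i v k =
  (i ≤ val v) × (val v ≤ k) ×
  (i ≡ val v → val v < k → IsX v) × (i < val v → val v ≡ k → IsY v)

<ᵒ-ᵒ<⇒interlaces : ∀ {i v k} → i <ᵒ v → v ᵒ< k → Interlaces i v k
<ᵒ-ᵒ<⇒interlaces (<x i≤j) (x< j<k) =
  i≤j , <⇒≤ j<k , (λ _ _ → isx _) , λ _ j≡k → ⊥-elim (<⇒≢ j<k j≡k)
<ᵒ-ᵒ<⇒interlaces (<y i<j) (y< j≤k) =
  <⇒≤ i<j , j≤k , (λ i≡j _ → ⊥-elim (<⇒≢ i<j i≡j)) , λ _ _ → isy _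

interlaces⇒<ᵒ-ᵒ< : ∀ {i v k} → InX v → i < k → Interlaces i v k → i <ᵒ v × v ᵒ< k
interlaces⇒<ᵒ-ᵒ< {i} {_} {k} (ix j) i<k (i≤j , j≤k , _ , j≡k⇒y) =
  <x i≤j , x< (≤∧≢⇒< j≤k λ j≡k → case j≡k⇒y (subst (i <_) (sym j≡k) i<k) j≡k of λ ())
interlaces⇒<ᵒ-ᵒ< {i} {_} {k} (iy j) i<k (i≤j , j≤k , i≡j⇒x , _) =
  <y (≤∧≢⇒< i≤j λ i≡j → case i≡j⇒x i≡j (subst (_< k) i≡j i<k) of λ ()) , y< j≤k

-- The possible entries of a row of rank t when rows 1, …, n − 1 are X-rows;
-- ValidSym rules out y 0.
data Entry : ℕ → Sym → Set where
  right  : ∀ i → Entry 1 (x i)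
  left   : ∀ j → Entry 1 (y (suc j))
  bottom : ∀ i → Entry 0 (num i)

InX-valid⇒Entry : ∀ {n s} → InX s → ValidSym n s → Entry 1 s
InX-valid⇒Entry (ix i) _ = right i
InX-valid⇒Entry (iy .(suc j)) (vy {suc j} _ _) = left j

left⇔<ᵒ : ∀ {t u v} → Entry t u → Entry 1 v →
  ((lv t u ℤ.≤ lv 1 v) × (IsY u → lv t u ℤ.< lv 1 v)) ⇔ val u <ᵒ v
left⇔<ᵒ (right i) (right j) =
  mk⇔ (λ { (+≤+ i≤j , _) → <x i≤j }) λ { (<x i≤j) → +≤+ i≤j , λ () }
left⇔<ᵒ (right i) (left j) =
  mk⇔ (λ { (+≤+ i≤j , _) → <y (s≤s i≤j) }) λ { (<y i<1+j) → +≤+ (≤-pred i<1+j) , λ () }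
left⇔<ᵒ (left i) (right j) =
  mk⇔ (λ { (_ , strict) → case strict (isy _) of λ { (+<+ i<j) → <x i<j } })
      λ { (<x i<j) → +≤+ (<⇒≤ i<j) , λ _ → +<+ i<j }
left⇔<ᵒ (left i) (left j) =
  mk⇔ (λ { (_ , strict) → case strict (isy _) of λ { (+<+ i<j) → <y (s≤s i<j) } })
      λ { (<y 1+i<1+j) → +≤+ (<⇒≤ (≤-pred 1+i<1+j)) , λ _ → +<+ (≤-pred 1+i<1+j) }
left⇔<ᵒ (bottom i) (right j) =
  mk⇔ (λ { (+≤+ i≤j , _) → <x i≤j }) λ { (<x i≤j) → +≤+ i≤j , λ () }
left⇔<ᵒ (bottom i) (left j) =
  mk⇔ (λ { (+≤+ i≤j , _) → <y (s≤s i≤j) }) λ { (<y i<1+j) → +≤+ (≤-pred i<1+j) , λ () }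

+1≤⇔< : ∀ {j k} → j + 1 ≤ k ⇔ j < k
+1≤⇔< {j} {k} = mk⇔ (subst (_≤ k) (+-comm j 1)) (subst (_≤ k) (+-comm 1 j))

<+1⇔≤ : ∀ {j k} → j < k + 1 ⇔ j ≤ k
<+1⇔≤ {j} {k} = mk⇔ (λ j<k+1 → ≤-pred (subst (suc j ≤_) (+-comm k 1) j<k+1))
                    (λ j≤k → subst (suc j ≤_) (+-comm 1 k) (s≤s j≤k))

right⇔ᵒ< : ∀ {t v w} → Entry 1 v → Entry t w →
  ((rv 1 v ℤ.≤ rv t w) × (IsX w → rv 1 v ℤ.< rv t w)) ⇔ v ᵒ< val w
right⇔ᵒ< (right j) (right k) =
  mk⇔ (λ { (_ , strict) → case strict (isx k) of λ { (+<+ j+1<k+1) → x< (+-cancelʳ-< 1 j k j+1<k+1) } })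
      λ { (x< j<k) → +≤+ (<⇒≤ (+-monoˡ-< 1 j<k)) , λ _ → +<+ (+-monoˡ-< 1 j<k) }
right⇔ᵒ< (right j) (left k) =
  mk⇔ (λ { (+≤+ j+1≤k , _) → x< (to +1≤⇔< j+1≤k) }) λ { (x< j<k) → +≤+ (from +1≤⇔< j<k) , λ () }
right⇔ᵒ< (right j) (bottom k) =
  mk⇔ (λ { (+≤+ j+1≤k , _) → x< (to +1≤⇔< j+1≤k) }) λ { (x< j<k) → +≤+ (from +1≤⇔< j<k) , λ () }
right⇔ᵒ< (left j) (right k) =
  mk⇔ (λ { (_ , strict) → case strict (isx k) of λ { (+<+ j<k+1) → y< (to <+1⇔≤ j<k+1) } })
      λ { (y< j≤k) → +≤+ (<⇒≤ (from <+1⇔≤ j≤k)) , λ _ → +<+ (from <+1⇔≤ j≤k) }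
right⇔ᵒ< (left j) (left k) = mk⇔ (λ { (+≤+ j≤k , _) → y< j≤k }) λ { (y< j≤k) → +≤+ j≤k , λ () }
right⇔ᵒ< (left j) (bottom k) = mk⇔ (λ { (+≤+ j≤k , _) → y< j≤k }) λ { (y< j≤k) → +≤+ j≤k , λ () }

Diagonal : ℕ → ℕ → Sym → Sym → Sym → Set
Diagonal t t′ u v w =
  (lv t u ℤ.≤ lv t′ v) × (rv t′ v ℤ.≤ rv t w) ×
  (IsY u → lv t u ℤ.< lv t′ v) × (IsX w → rv t′ v ℤ.< rv t w)

diagonal⇔<ᵒ-ᵒ< : ∀ {t u v w} → Entry t u → Entry 1 v → Entry t w →
  Diagonal t 1 u v w ⇔ (val u <ᵒ v × v ᵒ< val w)
diagonal⇔<ᵒ-ᵒ< eu ev ew = mk⇔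
  (λ (l , r , l< , r<) → to (left⇔<ᵒ eu ev) (l , l<) , to (right⇔ᵒ< ev ew) (r , r<))
  λ (i<v , v<k) →
    let (l , l<) = from (left⇔<ᵒ eu ev) i<v ; (r , r<) = from (right⇔ᵒ< ev ew) v<k
    in l , r , l< , r<

ᵒ<-<ᵒ⇒lv< : ∀ {u w β} → Entry 1 u → Entry 1 w → u ᵒ< β → β <ᵒ w → lv 1 u ℤ.< lv 1 w
ᵒ<-<ᵒ⇒lv< (right i) (right k) (x< i<β) (<x β≤k) = +<+ (<-≤-trans i<β β≤k)
ᵒ<-<ᵒ⇒lv< (right i) (left k) (x< i<β) (<y β<1+k) = +<+ (<-≤-trans i<β (≤-pred β<1+k))
ᵒ<-<ᵒ⇒lv< (left i) (right k) (y< i<β) (<x β≤k) = +<+ (<-≤-trans i<β β≤k)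
ᵒ<-<ᵒ⇒lv< (left i) (left k) (y< i<β) (<y β<1+k) = +<+ (<-≤-trans i<β (≤-pred β<1+k))

constant-below : ∀ {A : Set} {f : ℕ → A} m → (∀ r → r < m → f r ≡ f (suc r)) →
  ∀ {r} → r ≤ m → f r ≡ f m
constant-below zero step z≤n = refl
constant-below (suc m) step r≤1+m with m≤n⇒m<n∨m≡n r≤1+m
... | inj₂ refl = refl
... | inj₁ r<1+m =
  trans (constant-below m (λ r r<m → step r (m<n⇒m<1+n r<m)) (≤-pred r<1+m)) (step m ≤-refl)

InX⇒¬InV : ∀ {k s} → InX s → ¬ InV k s
InX⇒¬InV (ix i) ()
InX⇒¬InV (iy j) ()

xRow⇒rank-stable : ∀ {n T rk r} → IsRanking n T rk → 1 ≤ r → r < n → XRow T r →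
  rk (r ∸ 1) ≡ rk r
xRow⇒rank-stable (_ , _ , step) 1≤r r<n xRow with step _ 1≤r r<n
... | inj₁ (_ , stable) = stable
... | inj₂ (vRow , _) = contradiction (vRow 1 ≤-refl 1≤r) (InX⇒¬InV (xRow 1 ≤-refl 1≤r))

XRanks : ℕ → (ℕ → ℕ) → Set
XRanks n rk = rk n ≡ 0 × (∀ r → r < n → rk r ≡ 1)

isRanking⇒xRanks : ∀ {n T rk} → IsRanking n T rk → (∀ r → 1 ≤ r → r < n → XRow T r) →
  XRanks n rk
isRanking⇒xRanks {zero} (rk[0]≡0 , _) _ = rk[0]≡0 , λ _ ()
isRanking⇒xRanks {suc m} {rk = rk} ranking@(rk[1+m]≡0 , rk[m]≡1 , _) xRows =
  rk[1+m]≡0 , λ r r<1+m → trans (constant-below m stable (≤-pred r<1+m)) rk[m]≡1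
  where
  stable : ∀ r → r < m → rk r ≡ rk (suc r)
  stable r r<m = xRow⇒rank-stable ranking (s≤s z≤n) (s≤s r<m) (xRows (suc r) (s≤s z≤n) (s≤s r<m))

xRank : ℕ → ℕ → ℕ
xRank zero _ = 0
xRank (suc n) zero = 1
xRank (suc n) (suc r) = xRank n r

xRank-< : ∀ {n r} → r < n → xRank n r ≡ 1
xRank-< {suc n} {zero} _ = refl
xRank-< {suc n} {suc r} (s≤s r<n) = xRank-< r<n

xRank-self : ∀ n → xRank n n ≡ 0
xRank-self zero = refl
xRank-self (suc n) = xRank-self n

xRank-xRanks : ∀ n → XRanks n (xRank n)
xRank-xRanks n = xRank-self n , λ _ → xRank-<

xRank-isRanking : ∀ {n T} → 1 ≤ n → (∀ r → 1 ≤ r → r < n → XRow T r) → IsRanking n T (xRank n)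
xRank-isRanking {suc m} _ xRows = xRank-self (suc m) , xRank-< (n<1+n m) , λ r 1≤r r<1+m →
  inj₁ (xRows r 1≤r r<1+m , trans (xRank-< (≤-<-trans (m∸n≤m r 1) r<1+m)) (sym (xRank-< r<1+m)))

module XTriangle {n : ℕ} {T : Tri} (triangle : IsTriangle n T)
                 (xRows : ∀ r → 1 ≤ r → r < n → XRow T r) where

  bottom-row : ∀ {e p} → e ≡ n → 1 ≤ p → p ≤ e → T e p ≡ num p
  bottom-row refl = proj₁ triangle _

  oriented : ∀ {r p} → 1 ≤ r → r < n → 1 ≤ p → p ≤ r → Entry 1 (T r p)
  oriented 1≤r r<n 1≤p p≤r =
    InX-valid⇒Entry (xRows _ 1≤r r<n _ 1≤p p≤r) (proj₂ triangle _ _ 1≤r r<n 1≤p p≤r)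

  entry : ∀ {rk e p} → XRanks n rk → 1 ≤ p → p ≤ e → e ≤ n → Entry (rk e) (T e p)
  entry {rk} {e} {p} (rk[n]≡0 , rk≡1) 1≤p p≤e e≤n with m≤n⇒m<n∨m≡n e≤n
  ... | inj₁ e<n = subst (λ t → Entry t (T e p)) (sym (rk≡1 e e<n))
                         (oriented (≤-trans 1≤p p≤e) e<n 1≤p p≤e)
  ... | inj₂ refl = subst₂ Entry (sym rk[n]≡0) (sym (bottom-row refl 1≤p p≤e)) (bottom p)

  arrangement⇔ : ∀ {rk k p} → XRanks n rk → 1 ≤ k → k < n → 1 ≤ p → p ≤ k →
    Diagonal (rk (suc k)) (rk k) (T (suc k) p) (T k p) (T (suc k) (suc p)) ⇔
    (val (T (suc k) p) <ᵒ T k p × T k p ᵒ< val (T (suc k) (suc p)))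
  arrangement⇔ {rk} {k} {p} ranks@(_ , rk≡1) 1≤k k<n 1≤p p≤k =
    subst (λ t → Diagonal (rk (suc k)) t (T (suc k) p) (T k p) (T (suc k) (suc p)) ⇔ _)
          (sym (rk≡1 k k<n))
          (diagonal⇔<ᵒ-ᵒ< (entry ranks 1≤p (m≤n⇒m≤1+n p≤k) k<n)
                          (oriented 1≤k k<n 1≤p p≤k)
                          (entry ranks (s≤s z≤n) (s≤s p≤k) k<n))

  admissible⇒InO : Admissible n T → InO n T
  admissible⇒InO (rk , ranking , diagonal , _) =
    (λ r p 1≤r r<n → xRows r 1≤r r<n p) ,
    (λ { (suc k) p _ 1+k<n 1≤p (s≤s p≤k) →
           uncurry <ᵒ-ᵒ<⇒< (between (≤-trans 1≤p p≤k) (<⇒≤ 1+k<n) 1≤p p≤k) }) ,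
    λ k p 1≤k k<n 1≤p p≤k → uncurry <ᵒ-ᵒ<⇒interlaces (between 1≤k k<n 1≤p p≤k)
    where
    between : ∀ {k p} → 1 ≤ k → k < n → 1 ≤ p → p ≤ k →
      val (T (suc k) p) <ᵒ T k p × T k p ᵒ< val (T (suc k) (suc p))
    between {k} {p} 1≤k k<n 1≤p p≤k =
      to (arrangement⇔ (isRanking⇒xRanks ranking xRows) 1≤k k<n 1≤p p≤k)
         (diagonal (suc k) p (s≤s 1≤k) k<n 1≤p (s≤s p≤k))

  InO⇒admissible : 1 ≤ n → InO n T → Admissible n T
  InO⇒admissible 1≤n (inX , increasing , interlaces) =
    xRank n , xRank-isRanking 1≤n xRows , diagonal , row
    where
    increasing′ : ∀ {e p} → 1 ≤ e → e ≤ n → 1 ≤ p → p < e → val (T e p) < val (T e (suc p))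
    increasing′ {e} {p} 1≤e e≤n 1≤p p<e with m≤n⇒m<n∨m≡n e≤n
    ... | inj₁ e<n = increasing e p 1≤e e<n 1≤p p<e
    ... | inj₂ refl
      rewrite bottom-row refl 1≤p (<⇒≤ p<e) | bottom-row {p = suc p} refl (s≤s z≤n) p<e = n<1+n p

    between : ∀ {k p} → 1 ≤ k → k < n → 1 ≤ p → p ≤ k →
      val (T (suc k) p) <ᵒ T k p × T k p ᵒ< val (T (suc k) (suc p))
    between {k} {p} 1≤k k<n 1≤p p≤k =
      interlaces⇒<ᵒ-ᵒ< (inX k p 1≤k k<n 1≤p p≤k) (increasing′ (s≤s z≤n) k<n 1≤p (s≤s p≤k))
                       (interlaces k p 1≤k k<n 1≤p p≤k)

    diagonal : MonotoneDiagonal n T (xRank n)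
    diagonal (suc k) p (s≤s 1≤k) k<n 1≤p (s≤s p≤k) =
      from (arrangement⇔ (xRank-xRanks n) 1≤k k<n 1≤p p≤k) (between 1≤k k<n 1≤p p≤k)

    row : MonotoneRow n T (xRank n)
    row (suc k) p _ 1+k≤n 1≤p (s≤s p≤k) with m≤n⇒m<n∨m≡n 1+k≤n
    ... | inj₁ 1+k<n rewrite xRank-< 1+k<n =
      ᵒ<-<ᵒ⇒lv< (oriented (s≤s z≤n) 1+k<n 1≤p (m≤n⇒m≤1+n p≤k))
                (oriented (s≤s z≤n) 1+k<n (s≤s z≤n) (s≤s p≤k))
                (proj₂ (between (s≤s z≤n) 1+k<n 1≤p (m≤n⇒m≤1+n p≤k)))
                (proj₁ (between (s≤s z≤n) 1+k<n (s≤s z≤n) (s≤s p≤k)))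
    ... | inj₂ refl
      rewrite bottom-row refl 1≤p (m≤n⇒m≤1+n p≤k) | bottom-row {p = suc p} refl (s≤s z≤n) (s≤s p≤k) =
      +<+ (n<1+n p)

lemma2 : (n : ℕ) → 2 ≤ n → (T : Tri) → IsTriangle n T →
    (∀ r → 1 ≤ r → r < n → XRow T r) →
    (Admissible n T ⇔ InO n T)
lemma2 n 2≤n T triangle xRows =
  mk⇔ admissible⇒InO (InO⇒admissible (<⇒≤ 2≤n))
  where open XTriangle triangle xRows
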